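{- Let $q$ be an odd prime power, let $n\ge 2$ and $k\ge 1$ be integers, and let $\Gamma^{\square}(n,k,q)$ be the graph defined in the context. If $k \geq n/2$, then $\Gamma^{\square}(n,k,q)$ is $K_{2}$-free, i.e. it has no edges.
   Context: Let $q$ be an odd prime power and $\lambda$ a nonsquare in $\mathbb{F}_q$. Let $\lambda\mathrm{dot}_n$ denote the quadratic space $(\mathbb{F}_q^n, Q)$ with $Q(\mathbf{x})=x_1^2+\cdots+x_{n-1}^2+\lambda x_n^2$, and let $\perp$ denote orthogonality with respect to the symmetric bilinear form associated with $Q$. A $\mathrm{dot}_k$-subspace is a $k$-dimensional subspace $W\subseteq\mathbb{F}_q^n$ such that $(W,Q|_W)$ is isometrically isomorphic to $(\mathbb{F}_q^k, x_1^2+\cdots+x_k^2)$. The graph $\Gamma^{\square}(n,k,q)$ has as vertex set the set of $\mathrm{dot}_k$-subspaces of $\lambda\mathrm{dot}_n$, with two vertices $x,y$ adjacent if and only if $x\subseteq y^{\perp}$. -}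

module Defs where

open import Level using (Level; _⊔_)
open import Data.Nat using (ℕ; zero; suc)
open import Data.Fin as Fin using (Fin; inject₁; fromℕ)
open import Data.List using (List)
open import Data.List.Membership.Setoid using ()
open import Data.List.Relation.Unary.Any using (Any)
open import Data.Product using (Σ; _×_)
open import Relation.Nullary using (¬_)
open import Relation.Binary using (Decidable)
open import Algebra.Bundles using (CommutativeRing)

-- A finite field of odd characteristic (equivalently: F_q with q an odd prime power).
record FiniteOddField (c ℓ : Level) : Set (Level.suc (c ⊔ ℓ)) where
  field
    commRing : CommutativeRing c ℓ
  open CommutativeRing commRing public
  field
    _≟_      : Decidable _≈_
    0≉1      : ¬ (0# ≈ 1#)
    inverse  : ∀ x → ¬ (x ≈ 0#) → Σ Carrier (λ y → x * y ≈ 1#)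
    elements : List Carrier
    complete : ∀ x → Any (x ≈_) elements
    oddChar  : ¬ (1# + 1# ≈ 0#)

module Quadratic {c ℓ} (F : FiniteOddField c ℓ) where
  open FiniteOddField F hiding (zero)

  Vec : ℕ → Set c
  Vec n = Fin n → Carrier

  sumF : ∀ {n} → (Fin n → Carrier) → Carrier
  sumF {zero}  f = 0#
  sumF {suc n} f = f Fin.zero + sumF (λ i → f (Fin.suc i))

  dot : ∀ {k} → Vec k → Carrier
  dot x = sumF (λ i → x i * x i)

  Qλ : Carrier → ∀ {n} → Vec n → Carrier
  Qλ λ' {zero}  x = 0#
  Qλ λ' {suc m} x = dot (λ i → x (inject₁ i)) + λ' * (x (fromℕ m) * x (fromℕ m))

  _+ᵥ_ : ∀ {n} → Vec n → Vec n → Vec n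
  (x +ᵥ y) i = x i + y i

  Bλ : Carrier → ∀ {n} → Vec n → Vec n → Carrier
  Bλ λ' x y = Qλ λ' (x +ᵥ y) - Qλ λ' x - Qλ λ' y

  NonSquare : Carrier → Set (c ⊔ ℓ)
  NonSquare λ' = ∀ t → ¬ (t * t ≈ λ')

  apply : ∀ {k n} → (Fin k → Vec n) → Vec k → Vec n
  apply u a j = sumF (λ i → a i * u i j)

  -- The dot_k-subspaces of λdot_n are exactly the images of such maps.
  record DotEmbedding (λ' : Carrier) (k n : ℕ) : Set (c ⊔ ℓ) where
    field
      mat       : Fin k → Vec n
      injective : ∀ a b → (∀ j → apply mat a j ≈ apply mat b j) → ∀ i → a i ≈ b i
      isometry  : ∀ a → Qλ λ' (apply mat a) ≈ dot a

  -- subspace of a DotEmbedding: membership predicate (image of the map)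
  -- adjacency in Γ^□(n,k,q): x ⊆ y^⊥, i.e. every vector of x is orthogonal to every vector of y
  Adjacent : ∀ {λ' k n} → DotEmbedding λ' k n → DotEmbedding λ' k n → Set (c ⊔ ℓ)
  Adjacent {λ'} x y =
    ∀ a b → Bλ λ' (apply (DotEmbedding.mat x) a) (apply (DotEmbedding.mat y) b) ≈ 0#

-- If x ⊆ y^⊥, the basis rows of x and of y are 2k ≥ n vectors of λdot_n that are orthonormal for its
-- diagonal Gram weights w = (1, …, 1, λ).  The first n of them are the rows of a square matrix R with
-- R · diag w · Rᵀ = I, and taking determinants gives det R ² · λ = 1, so that λ = (λ · det R)² is a
-- square.  Determinants are given by the Leibniz formula; multiplicativity and invariance under
-- transposition follow because every alternating row-multilinear form D satisfies D A = det A · D I.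
module Submission where

open import Level using (_⊔_)
open import Data.Nat as ℕ using (ℕ; zero; suc; z≤n; s≤s)
import Data.Nat.Properties as ℕ
open import Data.Fin as Fin using (Fin; zero; suc; inject₁; fromℕ; toℕ; punchIn; splitAt)
import Data.Fin.Properties as Fin
open import Data.Fin.Induction using (<-weakInduction; >-weakInduction)
open import Data.Fin.Permutation using (Permutation′; permutation; _⟨$⟩ʳ_)
open import Data.Vec.Functional using ([]; _∷_; updateAt; removeAt; _++_)
open import Data.Vec.Functional.Properties using (updateAt-updates; updateAt-minimal; updateAt-commutes)
open import Data.Product using (∃; ∃₂; _×_; _,_; proj₁; proj₂)
open import Data.Sum using (inj₁; inj₂)
open import Data.Empty using (⊥-elim)
open import Function using (_∘_; const)
open import Function.Definitions using (Injective)
open import Relation.Nullary using (¬_; Dec; yes; no)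
open import Relation.Nullary.Decidable using (¬?; _×-dec_)
import Relation.Binary.PropositionalEquality as ≡
open ≡ using (_≡_; _≢_; _≗_)
open import Algebra.Bundles using (CommutativeRing)
open import Defs

τ : ∀ {m} → Fin m → Fin (suc m) → Fin (suc m)
τ {suc m} zero    zero          = suc zero
τ {suc m} zero    (suc zero)    = zero
τ {suc m} zero    (suc (suc i)) = suc (suc i)
τ {suc m} (suc a) zero          = zero
τ {suc m} (suc a) (suc i)       = suc (τ a i)

τ-involutive : ∀ {m} (a : Fin m) i → τ a (τ a i) ≡ i
τ-involutive {suc m} zero    zero          = ≡.refl
τ-involutive {suc m} zero    (suc zero)    = ≡.refl
τ-involutive {suc m} zero    (suc (suc i)) = ≡.refl
τ-involutive {suc m} (suc a) zero          = ≡.refl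
τ-involutive {suc m} (suc a) (suc i)       = ≡.cong suc (τ-involutive a i)

τ-inject₁ : ∀ {m} (a : Fin m) → τ a (inject₁ a) ≡ suc a
τ-inject₁ {suc m} zero    = ≡.refl
τ-inject₁ {suc m} (suc a) = ≡.cong suc (τ-inject₁ a)

τ-suc : ∀ {m} (a : Fin m) → τ a (suc a) ≡ inject₁ a
τ-suc {suc m} zero    = ≡.refl
τ-suc {suc m} (suc a) = ≡.cong suc (τ-suc a)

τ-fixes : ∀ {m} (a : Fin m) i → i ≢ inject₁ a → i ≢ suc a → τ a i ≡ i
τ-fixes {suc m} zero    zero          i≢a _    = ⊥-elim (i≢a ≡.refl)
τ-fixes {suc m} zero    (suc zero)    _   i≢1+a = ⊥-elim (i≢1+a ≡.refl)
τ-fixes {suc m} zero    (suc (suc i)) _   _    = ≡.refl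
τ-fixes {suc m} (suc a) zero          _   _    = ≡.refl
τ-fixes {suc m} (suc a) (suc i)       i≢a i≢1+a =
  ≡.cong suc (τ-fixes a i (i≢a ∘ ≡.cong suc) (i≢1+a ∘ ≡.cong suc))

τ-permutation : ∀ {m} → Fin m → Permutation′ (suc m)
τ-permutation a = permutation (τ a) (τ a) (τ-involutive a) (τ-involutive a)

inject₁≢suc : ∀ {m} (a : Fin m) → inject₁ a ≢ suc a
inject₁≢suc zero    ()
inject₁≢suc (suc a) eq = inject₁≢suc a (Fin.suc-injective eq)

[_>_] : ∀ {m} → Fin m → Fin m → ℕ
[ zero  > _     ] = 0
[ suc x > zero  ] = 1
[ suc x > suc y ] = [ x > y ]

[>]-true : ∀ {m} {x y : Fin m} → y Fin.< x → [ x > y ] ≡ 1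
[>]-true {x = suc x} {zero}  _         = ≡.refl
[>]-true {x = suc x} {suc y} (s≤s y<x) = [>]-true y<x

[>]-false : ∀ {m} {x y : Fin m} → y Fin.< x → [ y > x ] ≡ 0
[>]-false {x = suc x} {zero}  _         = ≡.refl
[>]-false {x = suc x} {suc y} (s≤s y<x) = [>]-false y<x

module _ where
  open import Algebra.Properties.CommutativeMonoid.Sum ℕ.+-0-commutativeMonoid using (sum; ∑-permute)
  open import Algebra.Properties.CommutativeSemigroup ℕ.+-commutativeSemigroup using (x∙yz≈y∙xz)

  inversions : ∀ {n m} → (Fin n → Fin m) → ℕ
  inversions {zero}  f = 0
  inversions {suc n} f = sum (λ j → [ f zero > f (suc j) ]) ℕ.+ inversions (λ j → f (suc j))

  inversions-∘τ : ∀ {n m} (a : Fin n) (f : Fin (suc n) → Fin m) →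
                  f (suc a) Fin.< f (inject₁ a) → suc (inversions (f ∘ τ a)) ≡ inversions f
  inversions-∘τ {suc n} zero f descent
    rewrite [>]-true descent | [>]-false descent =
      ≡.cong suc (x∙yz≈y∙xz (sum (λ j → [ f (suc zero) > f (suc (suc j)) ]))
                            (sum (λ j → [ f zero > f (suc (suc j)) ]))
                            (inversions (λ j → f (suc (suc j)))))
  inversions-∘τ {suc n} (suc a) f descent = begin
    suc (sum (λ j → [ f zero > f (suc (τ a j)) ]) ℕ.+ inversions (λ j → f (suc (τ a j))))
      ≡⟨ ≡.cong (λ s → suc (s ℕ.+ inversions (λ j → f (suc (τ a j)))))
                (∑-permute (λ j → [ f zero > f (suc j) ]) (τ-permutation a)) ⟨
    suc (sum (λ j → [ f zero > f (suc j) ]) ℕ.+ inversions (λ j → f (suc (τ a j))))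
      ≡⟨ ℕ.+-suc _ _ ⟨
    sum (λ j → [ f zero > f (suc j) ]) ℕ.+ suc (inversions (λ j → f (suc (τ a j))))
      ≡⟨ ≡.cong (sum (λ j → [ f zero > f (suc j) ]) ℕ.+_) (inversions-∘τ a (λ j → f (suc j)) descent) ⟩
    sum (λ j → [ f zero > f (suc j) ]) ℕ.+ inversions (λ j → f (suc j)) ∎
    where open ≡.≡-Reasoning

strictlyIncreasing⇒≗id : ∀ {n} (f : Fin (suc n) → Fin (suc n)) →
                         (∀ a → f (inject₁ a) Fin.< f (suc a)) → ∀ i → f i ≡ i
strictlyIncreasing⇒≗id {n} f increasing i =
  Fin.toℕ-injective (ℕ.≤-antisym (below i) (above i))
  where
  above : ∀ i → toℕ i ℕ.≤ toℕ (f i)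
  above = <-weakInduction (λ i → toℕ i ℕ.≤ toℕ (f i)) z≤n λ a ih →
    ℕ.≤-trans (s≤s (≡.subst (ℕ._≤ toℕ (f (inject₁ a))) (Fin.toℕ-inject₁ a) ih)) (increasing a)
  below : ∀ i → toℕ (f i) ℕ.≤ toℕ i
  below = >-weakInduction (λ i → toℕ (f i) ℕ.≤ toℕ i)
    (≡.subst (toℕ (f (fromℕ n)) ℕ.≤_) (≡.sym (Fin.toℕ-fromℕ n)) (Fin.toℕ≤pred[n] (f (fromℕ n))))
    λ a ih → ≡.subst (toℕ (f (inject₁ a)) ℕ.≤_) (≡.sym (Fin.toℕ-inject₁ a))
                     (ℕ.s≤s⁻¹ (ℕ.≤-trans (increasing a) ih))

splitAt-apart : ∀ N {M} {i i′ : Fin (N ℕ.+ M)} {a b} → splitAt N i ≡ inj₁ a → splitAt N i′ ≡ inj₂ b → i ≢ i′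
splitAt-apart N eq eq′ ≡.refl with () ← ≡.trans (≡.sym eq) eq′

Collision : ∀ {n m} → (Fin n → Fin m) → Set
Collision f = ∃₂ λ i j → i ≢ j × f i ≡ f j

collision? : ∀ {n m} (f : Fin n → Fin m) → Dec (Collision f)
collision? f = Fin.any? λ i → Fin.any? λ j → ¬? (i Fin.≟ j) ×-dec (f i Fin.≟ f j)

noCollision⇒surjective : ∀ {n} (f : Fin n → Fin n) → ¬ Collision f → ∀ r → ∃ λ i → f i ≡ r
noCollision⇒surjective f noCollision r with Fin.any? (λ i → f i Fin.≟ r)
... | yes hit = hit
noCollision⇒surjective {suc n} f noCollision r | no miss =
  ⊥-elim (Fin.<⇒notInjective (ℕ.n<1+n n) squeezed-injective)
  where
  missed : ∀ i → r ≢ f i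
  missed i r≡fi = miss (i , ≡.sym r≡fi)
  squeezed : Fin (suc n) → Fin n
  squeezed i = Fin.punchOut (missed i)
  squeezed-injective : Injective _≡_ _≡_ squeezed
  squeezed-injective {i} {j} eq with i Fin.≟ j
  ... | yes i≡j = i≡j
  ... | no i≢j = ⊥-elim (noCollision (i , j , i≢j , Fin.punchOut-injective (missed i) (missed j) eq))

module Determinant {c ℓ} (R : CommutativeRing c ℓ) where
  open CommutativeRing R hiding (zero)
  open import Algebra.Properties.Ring ring
    using (+-inverseʳ-unique; -‿distribˡ-*; -‿distribʳ-*; -‿involutive; -0#≈0#; -1*x≈-x)
  open import Algebra.Properties.CommutativeSemigroup *-commutativeSemigroup using (x∙yz≈y∙xz; x∙yz≈z∙yx; interchange)
  open import Algebra.Properties.Semiring.Sum semiring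
    using (∑-distrib-+; ∑-comm; ∑-permute; *-distribˡ-sum; sum-replicate-zero; sum-cong-≋)
    renaming (sum to ∑)
  open import Algebra.Properties.CommutativeMonoid.Sum *-commutativeMonoid
    using ()
    renaming ( sum to ∏; sum-cong-≋ to ∏-cong; sum-cong-≗ to ∏-cong-≗; ∑-permute to ∏-permute
             ; sum-replicate-zero to ∏-replicate-1; sum-remove to ∏-remove; ∑-distrib-+ to ∏-distrib-*)
  open import Relation.Binary.Reasoning.Setoid setoid

  ∑-cong : ∀ {n} {s t : Fin n → Carrier} → (∀ i → s i ≈ t i) → ∑ s ≈ ∑ t
  ∑-cong = sum-cong-≋

  ∏-updateAt : ∀ {n} (t : Fin (suc n) → Carrier) i x → ∏ (updateAt t i (const x)) ≈ x * ∏ (removeAt t i)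
  ∏-updateAt t i x = trans (∏-remove {i = i} (updateAt t i (const x)))
    (*-cong (reflexive (updateAt-updates i t))
            (∏-cong λ j → reflexive (updateAt-minimal (punchIn i j) i t (Fin.punchInᵢ≢i i j))))

  ∏-zero : ∀ {n} (t : Fin n → Carrier) i → t i ≈ 0# → ∏ t ≈ 0#
  ∏-zero {suc n} t i tᵢ≈0 = trans (∏-remove {i = i} t) (trans (*-congʳ tᵢ≈0) (zeroˡ _))

  δ : ∀ {n} → Fin n → Fin n → Carrier
  δ zero    zero    = 1#
  δ zero    (suc j) = 0#
  δ (suc i) zero    = 0#
  δ (suc i) (suc j) = δ i j

  δ-sym : ∀ {n} (i j : Fin n) → δ i j ≡ δ j i
  δ-sym zero    zero    = ≡.refl
  δ-sym zero    (suc j) = ≡.refl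
  δ-sym (suc i) zero    = ≡.refl
  δ-sym (suc i) (suc j) = δ-sym i j

  δ-refl : ∀ {n} (i : Fin n) → δ i i ≡ 1#
  δ-refl zero    = ≡.refl
  δ-refl (suc i) = δ-refl i

  δ-≢ : ∀ {n} {i j : Fin n} → i ≢ j → δ i j ≡ 0#
  δ-≢ {i = zero}  {zero}  i≢j = ⊥-elim (i≢j ≡.refl)
  δ-≢ {i = zero}  {suc j} _   = ≡.refl
  δ-≢ {i = suc i} {zero}  _   = ≡.refl
  δ-≢ {i = suc i} {suc j} i≢j = δ-≢ (i≢j ∘ ≡.cong suc)

  δ-injective : ∀ {n m} {f : Fin n → Fin m} → Injective _≡_ _≡_ f → ∀ i j → δ (f i) (f j) ≡ δ i j
  δ-injective {f = f} f-injective i j with i Fin.≟ j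
  ... | yes ≡.refl = ≡.trans (δ-refl (f i)) (≡.sym (δ-refl i))
  ... | no i≢j     = ≡.trans (δ-≢ (i≢j ∘ f-injective)) (≡.sym (δ-≢ i≢j))

  ∑-δ : ∀ {n} (i : Fin n) (t : Fin n → Carrier) → ∑ (λ j → δ i j * t j) ≈ t i
  ∑-δ {suc n} zero    t = begin
    1# * t zero + ∑ (λ j → 0# * t (suc j))
      ≈⟨ +-cong (*-identityˡ _) (trans (∑-cong (λ j → zeroˡ (t (suc j)))) (sum-replicate-zero n)) ⟩
    t zero + 0#
      ≈⟨ +-identityʳ _ ⟩
    t zero ∎
  ∑-δ {suc n} (suc i) t = trans (+-cong (zeroˡ _) (∑-δ i (λ j → t (suc j)))) (+-identityˡ _)

  ∑-δʳ : ∀ {n} (t : Fin n → Carrier) j → ∑ (λ i → t i * δ i j) ≈ t j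
  ∑-δʳ {n} t j = trans (∑-cong {n} λ i → trans (*-comm _ _) (*-congʳ (reflexive (δ-sym i j)))) (∑-δ j t)

  sgn : ∀ {m} → Fin m → Fin m → Carrier
  sgn zero    zero    = 0#
  sgn zero    (suc y) = 1#
  sgn (suc x) zero    = - 1#
  sgn (suc x) (suc y) = sgn x y

  sgn-refl : ∀ {m} (x : Fin m) → sgn x x ≈ 0#
  sgn-refl zero    = refl
  sgn-refl (suc x) = sgn-refl x

  sgn-antisym : ∀ {m} (x y : Fin m) → sgn y x ≈ - sgn x y
  sgn-antisym zero    zero    = sym -0#≈0#
  sgn-antisym zero    (suc y) = refl
  sgn-antisym (suc x) zero    = sym (-‿involutive 1#)
  sgn-antisym (suc x) (suc y) = sgn-antisym x y

  -- ε f is the product of sgn (f i) (f j) over i < j: the sign of f if f is injective, and 0 otherwise.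
  ε : ∀ {n m} → (Fin n → Fin m) → Carrier
  ε {zero}  f = 1#
  ε {suc n} f = ∏ (λ j → sgn (f zero) (f (suc j))) * ε (λ j → f (suc j))

  ε-≗ : ∀ {n m} {f g : Fin n → Fin m} → f ≗ g → ε f ≡ ε g
  ε-≗ {zero}  f≗g = ≡.refl
  ε-≗ {suc n} f≗g = ≡.cong₂ _*_ (∏-cong-≗ (λ j → ≡.cong₂ sgn (f≗g zero) (f≗g (suc j))))
                                (ε-≗ (λ j → f≗g (suc j)))

  ε-suc : ∀ {n m} (f : Fin n → Fin m) → ε (λ i → suc (f i)) ≡ ε f
  ε-suc {zero}  f = ≡.refl
  ε-suc {suc n} f = ≡.cong (∏ (λ j → sgn (f zero) (f (suc j))) *_) (ε-suc (λ j → f (suc j)))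

  ε-id : ∀ {n} → ε {n} (λ i → i) ≈ 1#
  ε-id {zero}  = refl
  ε-id {suc n} = begin
    ∏ {n} (λ _ → 1#) * ε {n} (λ j → suc j) ≈⟨ *-cong (∏-replicate-1 n) (reflexive (ε-suc {n} (λ j → j))) ⟩
    1# * ε {n} {n} (λ j → j)               ≈⟨ *-identityˡ _ ⟩
    ε {n} {n} (λ j → j)                    ≈⟨ ε-id {n} ⟩
    1#                                     ∎

  ε-collision : ∀ {n m} (f : Fin n → Fin m) {i j} → i ≢ j → f i ≡ f j → ε f ≈ 0#
  ε-collision f {zero}  {zero}  i≢j _ = ⊥-elim (i≢j ≡.refl)
  ε-collision f {zero}  {suc j} _ fᵢ≡fⱼ = trans (*-congʳ (∏-zero _ j
    (trans (reflexive (≡.cong (λ x → sgn x (f (suc j))) fᵢ≡fⱼ)) (sgn-refl (f (suc j)))))) (zeroˡ _)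
  ε-collision f {suc i} {zero}  _ fᵢ≡fⱼ = trans (*-congʳ (∏-zero _ i
    (trans (reflexive (≡.cong (sgn (f zero)) fᵢ≡fⱼ)) (sgn-refl (f zero))))) (zeroˡ _)
  ε-collision f {suc i} {suc j} i≢j fᵢ≡fⱼ =
    trans (*-congˡ (ε-collision (λ k → f (suc k)) (i≢j ∘ ≡.cong suc) fᵢ≡fⱼ)) (zeroʳ _)

  ε-∘τ : ∀ {n m} (a : Fin n) (f : Fin (suc n) → Fin m) → ε (f ∘ τ a) ≈ - ε f
  ε-∘τ {suc n} zero f = begin
    (sgn f₁ f₀ * A) * (B * E)     ≈⟨ *-congʳ (*-congʳ (sgn-antisym f₀ f₁)) ⟩
    ((- sgn f₀ f₁) * A) * (B * E) ≈⟨ *-congʳ (sym (-‿distribˡ-* _ _)) ⟩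
    - (sgn f₀ f₁ * A) * (B * E)   ≈⟨ sym (-‿distribˡ-* _ _) ⟩
    - ((sgn f₀ f₁ * A) * (B * E)) ≈⟨ -‿cong (interchange _ _ _ _) ⟩
    - ((sgn f₀ f₁ * B) * (A * E)) ∎
    where
    f₀ = f zero
    f₁ = f (suc zero)
    A = ∏ (λ j → sgn f₁ (f (suc (suc j))))
    B = ∏ (λ j → sgn f₀ (f (suc (suc j))))
    E = ε (λ j → f (suc (suc j)))
  ε-∘τ {suc n} (suc a) f = begin
    ∏ (λ j → sgn (f zero) (f (suc (τ a j)))) * ε (λ j → f (suc (τ a j)))
      ≈⟨ *-cong (sym (∏-permute (λ j → sgn (f zero) (f (suc j))) (τ-permutation a))) (ε-∘τ a (λ j → f (suc j))) ⟩
    ∏ (λ j → sgn (f zero) (f (suc j))) * - ε (λ j → f (suc j))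
      ≈⟨ sym (-‿distribʳ-* _ _) ⟩
    - (∏ (λ j → sgn (f zero) (f (suc j))) * ε (λ j → f (suc j))) ∎

  Extensional : ∀ {n m} → ((Fin n → Fin m) → Carrier) → Set ℓ
  Extensional h = ∀ {f g} → f ≗ g → h f ≈ h g

  record IsAlternating {n m} (h : (Fin (suc n) → Fin m) → Carrier) : Set (c ⊔ ℓ) where
    field
      resp-≗    : Extensional h
      flip-∘τ   : ∀ f a → h (f ∘ τ a) ≈ - h f
      repeat⇒0  : ∀ f a → f (inject₁ a) ≡ f (suc a) → h f ≈ 0#

  -- Bubble sort: each swap of a descent removes one inversion.
  isAlternating⇒≈ε* : ∀ {n} {h} → IsAlternating {n} h → ∀ f → h f ≈ ε f * h (λ i → i)
  isAlternating⇒≈ε* {n} {h} alt f = byInversions (inversions f) f ≡.refl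
    where
    open IsAlternating alt
    byInversions : ∀ k f → inversions f ≡ k → h f ≈ ε f * h (λ i → i)
    byInversions k f _ with Fin.any? (λ a → f (suc a) Fin.<? f (inject₁ a))
    byInversions zero    f inv≡0 | yes (a , descent) =
      ⊥-elim (ℕ.1+n≢0 (≡.trans (inversions-∘τ a f descent) inv≡0))
    byInversions (suc k) f inv≡1+k | yes (a , descent) = begin
      h f                                   ≈⟨ resp-≗ (λ i → ≡.cong f (≡.sym (τ-involutive a i))) ⟩
      h ((f ∘ τ a) ∘ τ a)                   ≈⟨ flip-∘τ (f ∘ τ a) a ⟩
      - h (f ∘ τ a)                         ≈⟨ -‿cong (byInversions k (f ∘ τ a) fewer) ⟩
      - (ε (f ∘ τ a) * h (λ i → i))         ≈⟨ -‿distribˡ-* _ _ ⟩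
      - ε (f ∘ τ a) * h (λ i → i)           ≈⟨ *-congʳ (-‿cong (ε-∘τ a f)) ⟩
      - - ε f * h (λ i → i)                 ≈⟨ *-congʳ (-‿involutive _) ⟩
      ε f * h (λ i → i)                     ∎
      where fewer = ℕ.suc-injective (≡.trans (inversions-∘τ a f descent) inv≡1+k)
    byInversions k f _ | no noDescent with Fin.any? (λ a → f (inject₁ a) Fin.≟ f (suc a))
    ... | yes (a , repeat) = begin
      h f                ≈⟨ repeat⇒0 f a repeat ⟩
      0#                 ≈⟨ zeroˡ _ ⟨
      0# * h (λ i → i)   ≈⟨ *-congʳ (ε-collision f (inject₁≢suc a) repeat) ⟨
      ε f * h (λ i → i)  ∎
    ... | no noRepeat = begin
      h f                         ≈⟨ resp-≗ f≗id ⟩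
      h (λ i → i)                 ≈⟨ *-identityˡ _ ⟨
      1# * h (λ i → i)            ≈⟨ *-congʳ (trans (reflexive (ε-≗ f≗id)) (ε-id {suc n})) ⟨
      ε f * h (λ i → i)           ∎
      where
      f≗id : f ≗ (λ i → i)
      f≗id = strictlyIncreasing⇒≗id f λ a →
        Fin.≤∧≢⇒< (ℕ.≮⇒≥ (noDescent ∘ (a ,_))) (noRepeat ∘ (a ,_))

  ε-∘ : ∀ {n} (π σ : Fin (suc n) → Fin (suc n)) → ε (π ∘ σ) ≈ ε σ * ε π
  ε-∘ π σ = isAlternating⇒≈ε* {h = λ s → ε (π ∘ s)} (record
    { resp-≗   = λ f≗g → reflexive (ε-≗ (≡.cong π ∘ f≗g))
    ; flip-∘τ  = λ f a → ε-∘τ a (π ∘ f)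
    ; repeat⇒0 = λ f a repeat → ε-collision (π ∘ f) (inject₁≢suc a) (≡.cong π repeat)
    }) σ

  ε-τ∘ : ∀ {n} (a : Fin n) (σ : Fin (suc n) → Fin (suc n)) → ε (τ a ∘ σ) ≈ - ε σ
  ε-τ∘ {n} a σ = begin
    ε (τ a ∘ σ)      ≈⟨ ε-∘ (τ a) σ ⟩
    ε σ * ε (τ a)    ≈⟨ *-congˡ (trans (ε-∘τ a (λ i → i)) (-‿cong (ε-id {suc n}))) ⟩
    ε σ * - 1#       ≈⟨ -‿distribʳ-* _ _ ⟨
    - (ε σ * 1#)     ≈⟨ -‿cong (*-identityʳ _) ⟩
    - ε σ            ∎

  ∑map : ∀ {n m} → ((Fin n → Fin m) → Carrier) → Carrier
  ∑map {zero}  h = h []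
  ∑map {suc n} h = ∑ (λ j → ∑map (λ f → h (j ∷ f)))

  ∷-extensional : ∀ {n m} {h : (Fin (suc n) → Fin m) → Carrier} → Extensional h → ∀ j → Extensional (λ f → h (j ∷ f))
  ∷-extensional ext j f≗g = ext λ { zero → ≡.refl ; (suc i) → f≗g i }

  ∑map-cong : ∀ {n m} {h h′ : (Fin n → Fin m) → Carrier} → (∀ f → h f ≈ h′ f) → ∑map h ≈ ∑map h′
  ∑map-cong {zero}  h≈h′ = h≈h′ []
  ∑map-cong {suc n} {m} h≈h′ = ∑-cong {m} λ j → ∑map-cong λ f → h≈h′ (j ∷ f)

  ∑map-distrib-+ : ∀ {n m} (h h′ : (Fin n → Fin m) → Carrier) → ∑map (λ f → h f + h′ f) ≈ ∑map h + ∑map h′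
  ∑map-distrib-+ {zero}  h h′ = refl
  ∑map-distrib-+ {suc n} {m} h h′ = trans (∑-cong {m} λ j → ∑map-distrib-+ (λ f → h (j ∷ f)) (λ f → h′ (j ∷ f)))
                                      (∑-distrib-+ {m} _ _)

  *-distribˡ-∑map : ∀ {n m} x (h : (Fin n → Fin m) → Carrier) → x * ∑map h ≈ ∑map (λ f → x * h f)
  *-distribˡ-∑map {zero}  x h = refl
  *-distribˡ-∑map {suc n} {m} x h = trans (*-distribˡ-sum {m} x _) (∑-cong {m} λ j → *-distribˡ-∑map x (λ f → h (j ∷ f)))

  -‿∑map : ∀ {n m} (h : (Fin n → Fin m) → Carrier) → ∑map (λ f → - h f) ≈ - ∑map h
  -‿∑map h = begin
    ∑map (λ f → - h f)        ≈⟨ ∑map-cong (λ f → -1*x≈-x (h f)) ⟨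
    ∑map (λ f → - 1# * h f)   ≈⟨ *-distribˡ-∑map (- 1#) h ⟨
    - 1# * ∑map h             ≈⟨ -1*x≈-x _ ⟩
    - ∑map h                  ∎

  ∑map-∘τ : ∀ {n m} (a : Fin n) {h : (Fin (suc n) → Fin m) → Carrier} → Extensional h →
            ∑map h ≈ ∑map (λ f → h (f ∘ τ a))
  ∑map-∘τ {suc n} {m} zero {h} ext = begin
    ∑ (λ j → ∑ (λ k → ∑map (λ f → h (j ∷ k ∷ f))))
      ≈⟨ ∑-comm (λ j k → ∑map (λ f → h (j ∷ k ∷ f))) ⟩
    ∑ (λ k → ∑ (λ j → ∑map (λ f → h (j ∷ k ∷ f))))
      ≈⟨ ∑-cong {m} (λ k → ∑-cong {m} λ j → ∑map-cong {n} {m} λ f → ext λ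
           { zero → ≡.refl ; (suc zero) → ≡.refl ; (suc (suc i)) → ≡.refl }) ⟩
    ∑ (λ k → ∑ (λ j → ∑map (λ f → h ((k ∷ j ∷ f) ∘ τ zero)))) ∎
  ∑map-∘τ {suc n} {m} (suc a) {h} ext = ∑-cong {m} λ j → trans (∑map-∘τ a (∷-extensional ext j))
    (∑map-cong {suc n} {m} λ f → ext {j ∷ (f ∘ τ a)} {(j ∷ f) ∘ τ (suc a)} λ { zero → ≡.refl ; (suc i) → ≡.refl })

  ∑map-permute : ∀ {n m} (π : Permutation′ m) {h : (Fin n → Fin m) → Carrier} → Extensional h →
                 ∑map h ≈ ∑map (λ f → h ((π ⟨$⟩ʳ_) ∘ f))
  ∑map-permute {zero}  π ext = ext λ ()
  ∑map-permute {suc n} {m} π {h} ext = begin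
    ∑ (λ j → ∑map (λ f → h (j ∷ f)))
      ≈⟨ ∑-permute _ π ⟩
    ∑ (λ j → ∑map (λ f → h ((π ⟨$⟩ʳ j) ∷ f)))
      ≈⟨ ∑-cong {m} (λ j → ∑map-permute π (∷-extensional ext (π ⟨$⟩ʳ j))) ⟩
    ∑ (λ j → ∑map (λ f → h ((π ⟨$⟩ʳ j) ∷ ((π ⟨$⟩ʳ_) ∘ f))))
      ≈⟨ ∑-cong {m} (λ j → ∑map-cong {n} {m} λ f → ext λ { zero → ≡.refl ; (suc i) → ≡.refl }) ⟩
    ∑ (λ j → ∑map (λ f → h ((π ⟨$⟩ʳ_) ∘ (j ∷ f)))) ∎

  ∑map-δ : ∀ {n m} (p : Fin n → Fin m) {C : (Fin n → Fin m) → Carrier} → Extensional C →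
           ∑map (λ f → ∏ (λ i → δ (p i) (f i)) * C f) ≈ C p
  ∑map-δ {zero}  p ext = trans (*-identityˡ _) (ext λ ())
  ∑map-δ {suc n} {m} p {C} ext = begin
    ∑ (λ j → ∑map (λ f → (δ (p zero) j * ∏ (λ i → δ (p (suc i)) (f i))) * C (j ∷ f)))
      ≈⟨ ∑-cong {m} (λ j → trans (∑map-cong {n} {m} λ f → *-assoc _ _ _) (sym (*-distribˡ-∑map {n} _ _))) ⟩
    ∑ (λ j → δ (p zero) j * ∑map (λ f → ∏ (λ i → δ (p (suc i)) (f i)) * C (j ∷ f)))
      ≈⟨ ∑-cong {m} (λ j → *-congˡ (∑map-δ (p ∘ suc) (∷-extensional ext j))) ⟩
    ∑ (λ j → δ (p zero) j * C (j ∷ (p ∘ suc)))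
      ≈⟨ ∑-δ (p zero) _ ⟩
    C (p zero ∷ (p ∘ suc))
      ≈⟨ ext (λ { zero → ≡.refl ; (suc i) → ≡.refl }) ⟩
    C p ∎

  Matrix : ℕ → ℕ → Set c
  Matrix m n = Fin m → Fin n → Carrier

  I : ∀ {n} → Matrix n n
  I = δ

  _[_]≔_ : ∀ {m n} → Matrix m n → Fin m → (Fin n → Carrier) → Matrix m n
  A [ r ]≔ u = updateAt A r (const u)

  ≔-cong : ∀ {m n} (A : Matrix m n) r {u v} → (∀ j → u j ≈ v j) → ∀ i j → (A [ r ]≔ u) i j ≈ (A [ r ]≔ v) i j
  ≔-cong A zero    u≈v zero    j = u≈v j
  ≔-cong A zero    u≈v (suc i) j = refl
  ≔-cong A (suc r) u≈v zero    j = refl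
  ≔-cong A (suc r) u≈v (suc i) j = ≔-cong (λ k → A (suc k)) r u≈v i j

  _[_]≔₂_,_ : ∀ {n m} → Matrix (suc n) m → Fin n → (Fin m → Carrier) → (Fin m → Carrier) → Matrix (suc n) m
  A [ a ]≔₂ u , v = (A [ suc a ]≔ v) [ inject₁ a ]≔ u

  ≔₂-inject₁ : ∀ {n m} (A : Matrix (suc n) m) a u v → (A [ a ]≔₂ u , v) (inject₁ a) ≡ u
  ≔₂-inject₁ A a u v = updateAt-updates (inject₁ a) (A [ suc a ]≔ v)

  ≔₂-suc : ∀ {n m} (A : Matrix (suc n) m) a u v → (A [ a ]≔₂ u , v) (suc a) ≡ v
  ≔₂-suc A a u v = ≡.trans (updateAt-minimal (suc a) (inject₁ a) (A [ suc a ]≔ v) (inject₁≢suc a ∘ ≡.sym))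
                           (updateAt-updates (suc a) A)

  ≔₂-comm : ∀ {n m} (A : Matrix (suc n) m) a u v → (A [ a ]≔₂ u , v) ≗ ((A [ inject₁ a ]≔ u) [ suc a ]≔ v)
  ≔₂-comm A a u v = updateAt-commutes (inject₁ a) (suc a) (inject₁≢suc a) A

  ≔₂-≗ : ∀ {n m} (A B : Matrix (suc n) m) a {u v} → u ≡ B (inject₁ a) → v ≡ B (suc a) →
         (∀ i → i ≢ inject₁ a → i ≢ suc a → A i ≡ B i) → (A [ a ]≔₂ u , v) ≗ B
  ≔₂-≗ A B a {u} {v} u≡ v≡ others i with i Fin.≟ inject₁ a | i Fin.≟ suc a
  ... | yes ≡.refl | _          = ≡.trans (≔₂-inject₁ A a u v) u≡
  ... | no _       | yes ≡.refl = ≡.trans (≔₂-suc A a u v) v≡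
  ... | no i≢ι     | no i≢σ     = ≡.trans (updateAt-minimal i (inject₁ a) _ i≢ι)
                                    (≡.trans (updateAt-minimal i (suc a) A i≢σ) (others i i≢ι i≢σ))

  record RowMultilinear {m n} (D : Matrix m n → Carrier) : Set (c ⊔ ℓ) where
    field
      cong        : ∀ {A B} → (∀ i j → A i j ≈ B i j) → D A ≈ D B
      additive    : ∀ A r u v → D (A [ r ]≔ (λ j → u j + v j)) ≈ D (A [ r ]≔ u) + D (A [ r ]≔ v)
      homogeneous : ∀ A r x u → D (A [ r ]≔ (λ j → x * u j)) ≈ x * D (A [ r ]≔ u)

    cong-≗ : ∀ {A B} → A ≗ B → D A ≈ D B
    cong-≗ A≗B = cong λ i j → reflexive (≡.cong (λ row → row j) (A≗B i))

    expand-row : ∀ {L} A r (x : Fin L → Carrier) (w : Fin L → Fin n → Carrier) →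
                 D (A [ r ]≔ (λ j → ∑ (λ l → x l * w l j))) ≈ ∑ (λ l → x l * D (A [ r ]≔ w l))
    expand-row {zero} A r x w = begin
      D (A [ r ]≔ (λ _ → 0#))          ≈⟨ cong (≔-cong A r λ _ → sym (zeroˡ 0#)) ⟩
      D (A [ r ]≔ (λ _ → 0# * 0#))     ≈⟨ homogeneous A r 0# (λ _ → 0#) ⟩
      0# * D (A [ r ]≔ (λ _ → 0#))     ≈⟨ zeroˡ _ ⟩
      0#                                ∎
    expand-row {suc L} A r x w = begin
      D (A [ r ]≔ (λ j → x zero * w zero j + ∑ (λ l → x (suc l) * w (suc l) j)))
        ≈⟨ additive A r _ _ ⟩
      D (A [ r ]≔ (λ j → x zero * w zero j)) + D (A [ r ]≔ (λ j → ∑ (λ l → x (suc l) * w (suc l) j)))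
        ≈⟨ +-cong (homogeneous A r (x zero) (w zero)) (expand-row A r (λ l → x (suc l)) (λ l → w (suc l))) ⟩
      x zero * D (A [ r ]≔ w zero) + ∑ (λ l → x (suc l) * D (A [ r ]≔ w (suc l))) ∎

  ∷-rowMultilinear : ∀ {m n} {D : Matrix (suc m) n → Carrier} → RowMultilinear D →
                     ∀ x → RowMultilinear (λ B → D (x ∷ B))
  ∷-rowMultilinear ml x = record
    { cong        = λ A≈B → cong λ { zero j → refl ; (suc i) j → A≈B i j }
    ; additive    = λ A r u v → trans (cong-≗ shift) (trans (additive (x ∷ A) (suc r) u v)
                                  (sym (+-cong (cong-≗ shift) (cong-≗ shift))))
    ; homogeneous = λ A r y u → trans (cong-≗ shift) (trans (homogeneous (x ∷ A) (suc r) y u)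
                                  (sym (*-congˡ (cong-≗ shift))))
    }
    where
    open RowMultilinear ml
    shift : ∀ {B r u} → (x ∷ (B [ r ]≔ u)) ≗ ((x ∷ B) [ suc r ]≔ u)
    shift zero    = ≡.refl
    shift (suc i) = ≡.refl

  expand : ∀ {m n} {D : Matrix m n → Carrier} → RowMultilinear D →
           ∀ A → D A ≈ ∑map (λ f → ∏ (λ i → A i (f i)) * D (λ i → I (f i)))
  expand {zero} ml A = trans (RowMultilinear.cong ml λ ()) (sym (*-identityˡ _))
  expand {suc m} {n} {D} ml A = begin
    D A
      ≈⟨ cong ≔-row ⟩
    D (A [ zero ]≔ (λ j → ∑ (λ l → A zero l * I l j)))
      ≈⟨ expand-row A zero (A zero) I ⟩
    ∑ (λ l → A zero l * D (A [ zero ]≔ I l))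
      ≈⟨ ∑-cong {n} (λ l → *-congˡ (trans (cong-≗ λ { zero → ≡.refl ; (suc i) → ≡.refl })
                                            (expand (∷-rowMultilinear ml (I l)) (λ i → A (suc i))))) ⟩
    ∑ (λ l → A zero l * ∑map (λ f → ∏ (λ i → A (suc i) (f i)) * D (I l ∷ (λ i → I (f i)))))
      ≈⟨ ∑-cong {n} (λ l → trans (*-distribˡ-∑map {m} _ _) (∑map-cong {m} {n} λ f →
           trans (sym (*-assoc _ _ _)) (*-congˡ (cong-≗ λ { zero → ≡.refl ; (suc i) → ≡.refl })))) ⟩
    ∑map (λ f → ∏ (λ i → A i (f i)) * D (λ i → I (f i))) ∎
    where
    open RowMultilinear ml
    ≔-row : ∀ i j → A i j ≈ (A [ zero ]≔ (λ j → ∑ (λ l → A zero l * I l j))) i j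
    ≔-row zero    j = sym (∑-δʳ (A zero) j)
    ≔-row (suc i) j = refl

  RowAlternating : ∀ {n m} → (Matrix (suc n) m → Carrier) → Set (c ⊔ ℓ)
  RowAlternating D = ∀ A a → (∀ j → A (inject₁ a) j ≈ A (suc a) j) → D A ≈ 0#

  -- Put x + y into both rows and expand: the two cross terms are D A and D (A ∘ τ a).
  alternating⇒flip-∘τ : ∀ {n m} {D : Matrix (suc n) m → Carrier} → RowMultilinear D → RowAlternating D →
                        ∀ A a → D (A ∘ τ a) ≈ - D A
  alternating⇒flip-∘τ {D = D} ml alt A a = +-inverseʳ-unique (D A) (D (A ∘ τ a)) (begin
    D A + D (A ∘ τ a)
      ≈⟨ +-cong (cong-≗ (≔₂-≗ A A a ≡.refl ≡.refl λ _ _ _ → ≡.refl))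
                (cong-≗ (≔₂-≗ A (A ∘ τ a) a (≡.cong A (≡.sym (τ-inject₁ a))) (≡.cong A (≡.sym (τ-suc a)))
                                λ i i≢ι i≢σ → ≡.cong A (≡.sym (τ-fixes a i i≢ι i≢σ)))) ⟨
    D (M x y) + D (M y x)
      ≈⟨ +-cong (+-identityˡ _) (+-identityʳ _) ⟨
    (0# + D (M x y)) + (D (M y x) + 0#)
      ≈⟨ +-cong (+-congʳ (repeated x)) (+-congˡ (repeated y)) ⟩
    (D (M x x) + D (M x y)) + (D (M y x) + D (M y y))
      ≈⟨ +-cong (linearInσ x) (linearInσ y) ⟨
    D (M x s) + D (M y s)
      ≈⟨ additive (A [ σ ]≔ s) ι x y ⟨
    D (M s s)
      ≈⟨ repeated s ⟨
    0# ∎)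
    where
    open RowMultilinear ml
    ι = inject₁ a
    σ = suc a
    x = A ι
    y = A σ
    s = λ j → x j + y j
    M : (Fin _ → Carrier) → (Fin _ → Carrier) → Matrix _ _
    M = A [ a ]≔₂_,_
    repeated : ∀ u → 0# ≈ D (M u u)
    repeated u = sym (alt (M u u) a λ j →
      reflexive (≡.cong (λ row → row j) (≡.trans (≔₂-inject₁ A a u u) (≡.sym (≔₂-suc A a u u)))))
    linearInσ : ∀ u → D (M u s) ≈ D (M u x) + D (M u y)
    linearInσ u = trans (cong-≗ (≔₂-comm A a u s)) (trans (additive (A [ ι ]≔ u) σ x y)
                    (sym (+-cong (cong-≗ (≔₂-comm A a u x)) (cong-≗ (≔₂-comm A a u y)))))

  ReadsOneEntry : ∀ {n m k} → ((Fin k → Carrier) → (Fin n → Fin m) → Carrier) → Set (c ⊔ ℓ)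
  ReadsOneEntry T = ∀ f → ∃₂ λ j C → ∀ w → T w f ≈ w j * C

  ∑map-additive : ∀ {n m k} {T : (Fin k → Carrier) → (Fin n → Fin m) → Carrier} → ReadsOneEntry T →
                  ∀ u v → ∑map (T (λ j → u j + v j)) ≈ ∑map (T u) + ∑map (T v)
  ∑map-additive {T = T} reads u v = trans (∑map-cong additive) (∑map-distrib-+ (T u) (T v))
    where
    additive : ∀ f → T (λ j → u j + v j) f ≈ T u f + T v f
    additive f with reads f
    ... | j , C , T≈ = trans (T≈ _) (trans (distribʳ C (u j) (v j)) (sym (+-cong (T≈ u) (T≈ v))))

  ∑map-homogeneous : ∀ {n m k} {T : (Fin k → Carrier) → (Fin n → Fin m) → Carrier} → ReadsOneEntry T →
                     ∀ x u → ∑map (T (λ j → x * u j)) ≈ x * ∑map (T u)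
  ∑map-homogeneous {T = T} reads x u = trans (∑map-cong homogeneous) (sym (*-distribˡ-∑map x (T u)))
    where
    homogeneous : ∀ f → T (λ j → x * u j) f ≈ x * T u f
    homogeneous f with reads f
    ... | j , C , T≈ = trans (T≈ _) (trans (*-assoc x (u j) C) (*-congˡ (sym (T≈ u))))

  det : ∀ {n} → Matrix n n → Carrier
  det A = ∑map (λ f → ε f * ∏ (λ i → A i (f i)))

  det-cong : ∀ {n} {A B : Matrix n n} → (∀ i j → A i j ≈ B i j) → det A ≈ det B
  det-cong A≈B = ∑map-cong λ f → *-congˡ (∏-cong λ i → A≈B i (f i))

  det-I : ∀ {n} → det (I {n}) ≈ 1#
  det-I {n} = trans (∑map-cong {n} {n} (λ f → *-comm (ε f) (∏ (λ i → δ i (f i)))))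
                    (trans (∑map-δ {n} (λ i → i) (reflexive ∘ ε-≗)) (ε-id {n}))

  diagonal-≔ : ∀ {n m} (A : Matrix n m) r w (f : Fin n → Fin m) →
               (λ i → (A [ r ]≔ w) i (f i)) ≗ updateAt (λ i → A i (f i)) r (const (w (f r)))
  diagonal-≔ A zero    w f zero    = ≡.refl
  diagonal-≔ A zero    w f (suc i) = ≡.refl
  diagonal-≔ A (suc r) w f zero    = ≡.refl
  diagonal-≔ A (suc r) w f (suc i) = diagonal-≔ (λ k → A (suc k)) r w (λ k → f (suc k)) i

  det-readsRow : ∀ {n} (A : Matrix n n) r → ReadsOneEntry (λ w f → ε f * ∏ (λ i → (A [ r ]≔ w) i (f i)))
  det-readsRow {suc n} A r f = f r , ε f * ∏ (removeAt (λ i → A i (f i)) r) , λ w → begin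
    ε f * ∏ (λ i → (A [ r ]≔ w) i (f i))
      ≈⟨ *-congˡ (reflexive (∏-cong-≗ (diagonal-≔ A r w f))) ⟩
    ε f * ∏ (updateAt (λ i → A i (f i)) r (const (w (f r))))
      ≈⟨ *-congˡ (∏-updateAt _ r (w (f r))) ⟩
    ε f * (w (f r) * ∏ (removeAt (λ i → A i (f i)) r))
      ≈⟨ x∙yz≈y∙xz _ _ _ ⟩
    w (f r) * (ε f * ∏ (removeAt (λ i → A i (f i)) r)) ∎

  det-rowMultilinear : ∀ {n} → RowMultilinear (det {n})
  det-rowMultilinear = record
    { cong        = det-cong
    ; additive    = λ A r → ∑map-additive (det-readsRow A r)
    ; homogeneous = λ A r → ∑map-homogeneous (det-readsRow A r)
    }

  det-unique : ∀ {n} {D : Matrix (suc n) (suc n) → Carrier} → RowMultilinear D → RowAlternating D →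
               ∀ A → D A ≈ det A * D I
  det-unique {n} {D} ml alt A = begin
    D A                                                 ≈⟨ expand ml A ⟩
    ∑map (λ f → ∏ (λ i → A i (f i)) * D (λ i → I (f i))) ≈⟨ ∑map-cong sign-out ⟩
    ∑map (λ f → D I * (ε f * ∏ (λ i → A i (f i))))      ≈⟨ *-distribˡ-∑map (D I) (λ f → ε f * ∏ (λ i → A i (f i))) ⟨
    D I * det A                                         ≈⟨ *-comm _ _ ⟩
    det A * D I                                         ∎
    where
    open RowMultilinear ml
    D∘I-isAlternating : IsAlternating (λ f → D (λ i → I (f i)))
    D∘I-isAlternating = record
      { resp-≗   = λ f≗g → cong-≗ (≡.cong I ∘ f≗g)
      ; flip-∘τ  = λ f a → alternating⇒flip-∘τ ml alt (λ i → I (f i)) a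
      ; repeat⇒0 = λ f a repeat → alt _ a λ j → reflexive (≡.cong (λ k → I k j) repeat)
      }
    sign-out : ∀ f → ∏ (λ i → A i (f i)) * D (λ i → I (f i)) ≈ D I * (ε f * ∏ (λ i → A i (f i)))
    sign-out f = trans (*-congˡ (isAlternating⇒≈ε* D∘I-isAlternating f)) (x∙yz≈z∙yx _ _ _)

  _*ₘ_ : ∀ {m n p} → Matrix m n → Matrix n p → Matrix m p
  (A *ₘ B) i k = ∑ (λ j → A i j * B j k)

  transpose : ∀ {m n} → Matrix m n → Matrix n m
  transpose A i j = A j i

  *ₘ-≔ : ∀ {m n p} (A : Matrix m n) (B : Matrix n p) r u →
         ((A [ r ]≔ u) *ₘ B) ≗ ((A *ₘ B) [ r ]≔ (λ k → ∑ (λ j → u j * B j k)))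
  *ₘ-≔ A B zero    u zero    = ≡.refl
  *ₘ-≔ A B zero    u (suc i) = ≡.refl
  *ₘ-≔ A B (suc r) u zero    = ≡.refl
  *ₘ-≔ A B (suc r) u (suc i) = *ₘ-≔ (λ k → A (suc k)) B r u i

  *ₘ-rowMultilinear : ∀ {m n p} {D : Matrix m p → Carrier} → RowMultilinear D →
                      ∀ (B : Matrix n p) → RowMultilinear (λ A → D (A *ₘ B))
  *ₘ-rowMultilinear {n = n} {D = D} ml B = record
    { cong        = λ A≈A′ → cong λ i k → ∑-cong {n} λ j → *-congʳ (A≈A′ i j)
    ; additive    = λ A r u v → begin
        D ((A [ r ]≔ (λ j → u j + v j)) *ₘ B)
          ≈⟨ cong-≗ (*ₘ-≔ A B r _) ⟩
        D ((A *ₘ B) [ r ]≔ (λ k → ∑ (λ j → (u j + v j) * B j k)))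
          ≈⟨ cong (≔-cong (A *ₘ B) r λ k → trans (∑-cong {n} λ j → distribʳ _ _ _) (∑-distrib-+ {n} _ _)) ⟩
        D ((A *ₘ B) [ r ]≔ (λ k → ∑ (λ j → u j * B j k) + ∑ (λ j → v j * B j k)))
          ≈⟨ additive (A *ₘ B) r _ _ ⟩
        D ((A *ₘ B) [ r ]≔ (λ k → ∑ (λ j → u j * B j k))) + D ((A *ₘ B) [ r ]≔ (λ k → ∑ (λ j → v j * B j k)))
          ≈⟨ +-cong (cong-≗ (*ₘ-≔ A B r u)) (cong-≗ (*ₘ-≔ A B r v)) ⟨
        D ((A [ r ]≔ u) *ₘ B) + D ((A [ r ]≔ v) *ₘ B) ∎
    ; homogeneous = λ A r x u → begin
        D ((A [ r ]≔ (λ j → x * u j)) *ₘ B)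
          ≈⟨ cong-≗ (*ₘ-≔ A B r _) ⟩
        D ((A *ₘ B) [ r ]≔ (λ k → ∑ (λ j → (x * u j) * B j k)))
          ≈⟨ cong (≔-cong (A *ₘ B) r λ k → trans (∑-cong {n} λ j → *-assoc _ _ _) (sym (*-distribˡ-sum {n} x _))) ⟩
        D ((A *ₘ B) [ r ]≔ (λ k → x * ∑ (λ j → u j * B j k)))
          ≈⟨ homogeneous (A *ₘ B) r x _ ⟩
        x * D ((A *ₘ B) [ r ]≔ (λ k → ∑ (λ j → u j * B j k)))
          ≈⟨ *-congˡ (cong-≗ (*ₘ-≔ A B r u)) ⟨
        x * D ((A [ r ]≔ u) *ₘ B) ∎
    }
    where open RowMultilinear ml

  *ₘ-rowAlternating : ∀ {m n p} {D : Matrix (suc m) p → Carrier} → RowAlternating D →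
                      ∀ (B : Matrix n p) → RowAlternating (λ A → D (A *ₘ B))
  *ₘ-rowAlternating {n = n} alt B A a rows≈ = alt (A *ₘ B) a λ k → ∑-cong {n} λ j → *-congʳ (rows≈ j)

  I-*ₘ : ∀ {n p} (B : Matrix n p) i k → (I *ₘ B) i k ≈ B i k
  I-*ₘ B i k = ∑-δ i (λ j → B j k)

  -- Only collision-free f contribute, and such an f meets row r exactly once.
  det-transposeReadsRow : ∀ {n} (A : Matrix n n) r →
                          ReadsOneEntry (λ w f → ε f * ∏ (λ i → transpose (A [ r ]≔ w) i (f i)))
  det-transposeReadsRow A r f with collision? f
  ... | yes (i , j , i≢j , fᵢ≡fⱼ) = r , 0# , λ w → begin
    ε f * ∏ (λ i → (A [ r ]≔ w) (f i) i) ≈⟨ *-congʳ (ε-collision f i≢j fᵢ≡fⱼ) ⟩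
    0# * ∏ (λ i → (A [ r ]≔ w) (f i) i)  ≈⟨ zeroˡ _ ⟩
    0#                                   ≈⟨ zeroʳ _ ⟨
    w r * 0#                             ∎
  det-transposeReadsRow {suc n} A r f | no noCollision with noCollision⇒surjective f noCollision r
  ... | i₀ , fi₀≡r = i₀ , ε f * ∏ (removeAt (λ i → A (f i) i) i₀) , λ w → begin
    ε f * ∏ (λ i → (A [ r ]≔ w) (f i) i)
      ≈⟨ *-congˡ (reflexive (∏-cong-≗ (readsAt w))) ⟩
    ε f * ∏ (updateAt (λ i → A (f i) i) i₀ (const (w i₀)))
      ≈⟨ *-congˡ (∏-updateAt _ i₀ (w i₀)) ⟩
    ε f * (w i₀ * ∏ (removeAt (λ i → A (f i) i) i₀))
      ≈⟨ x∙yz≈y∙xz _ _ _ ⟩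
    w i₀ * (ε f * ∏ (removeAt (λ i → A (f i) i) i₀)) ∎
    where
    readsAt : ∀ w → (λ i → (A [ r ]≔ w) (f i) i) ≗ updateAt (λ i → A (f i) i) i₀ (const (w i₀))
    readsAt w i with i Fin.≟ i₀
    ... | yes ≡.refl = ≡.trans (≡.cong (λ k → (A [ r ]≔ w) k i) fi₀≡r)
                         (≡.trans (≡.cong (λ row → row i) (updateAt-updates r A))
                                  (≡.sym (updateAt-updates i (λ i → A (f i) i))))
    ... | no i≢i₀ = ≡.trans (≡.cong (λ row → row i) (updateAt-minimal (f i) r A λ fᵢ≡r →
                              noCollision (i , i₀ , i≢i₀ , ≡.trans fᵢ≡r (≡.sym fi₀≡r))))
                            (≡.sym (updateAt-minimal i i₀ (λ i → A (f i) i) i≢i₀))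

  det-transpose-rowMultilinear : ∀ {n} → RowMultilinear (λ (A : Matrix n n) → det (transpose A))
  det-transpose-rowMultilinear = record
    { cong        = λ A≈B → det-cong λ i j → A≈B j i
    ; additive    = λ A r → ∑map-additive (det-transposeReadsRow A r)
    ; homogeneous = λ A r → ∑map-homogeneous (det-transposeReadsRow A r)
    }

  det-scaleRows : ∀ {n} (g : Fin n → Carrier) (A : Matrix n n) → det (λ i j → g i * A i j) ≈ ∏ g * det A
  det-scaleRows g A = trans (∑map-cong scale) (sym (*-distribˡ-∑map (∏ g) (λ f → ε f * ∏ (λ i → A i (f i)))))
    where
    scale : ∀ f → ε f * ∏ (λ i → g i * A i (f i)) ≈ ∏ g * (ε f * ∏ (λ i → A i (f i)))
    scale f = trans (*-congˡ (∏-distrib-* g (λ i → A i (f i)))) (x∙yz≈y∙xz _ _ _)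

  τ-rows : ∀ {n m} (A : Matrix (suc n) m) a → (∀ j → A (inject₁ a) j ≈ A (suc a) j) → ∀ i j → A (τ a i) j ≈ A i j
  τ-rows A a rows≈ i j with i Fin.≟ inject₁ a | i Fin.≟ suc a
  ... | yes ≡.refl | _          = trans (reflexive (≡.cong (λ k → A k j) (τ-inject₁ a))) (sym (rows≈ j))
  ... | no _       | yes ≡.refl = trans (reflexive (≡.cong (λ k → A k j) (τ-suc a))) (rows≈ j)
  ... | no i≢ι     | no i≢σ     = reflexive (≡.cong (λ k → A k j) (τ-fixes a i i≢ι i≢σ))

  module _ (+-double-injective : ∀ {x y} → x + x ≈ y + y → x ≈ y) where

    x≈-x⇒x≈0 : ∀ {x} → x ≈ - x → x ≈ 0#
    x≈-x⇒x≈0 {x} x≈-x = +-double-injective (trans (+-congˡ x≈-x) (trans (-‿inverseʳ x) (sym (+-identityʳ 0#))))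

    det-rowAlternating : ∀ {n} → RowAlternating (det {suc n})
    det-rowAlternating A a rows≈ = x≈-x⇒x≈0 (begin
      det A                                           ≈⟨ ∑map-∘τ a (λ f≗g → *-cong (reflexive (ε-≗ f≗g))
                                                          (reflexive (∏-cong-≗ λ i → ≡.cong (A i) (f≗g i)))) ⟩
      ∑map (λ f → ε (f ∘ τ a) * ∏ (λ i → A i (f (τ a i)))) ≈⟨ ∑map-cong swapped ⟩
      ∑map (λ f → - (ε f * ∏ (λ i → A i (f i))))     ≈⟨ -‿∑map (λ f → ε f * ∏ (λ i → A i (f i))) ⟩
      - det A                                         ∎)
      where
      swapped : ∀ f → ε (f ∘ τ a) * ∏ (λ i → A i (f (τ a i))) ≈ - (ε f * ∏ (λ i → A i (f i)))
      swapped f = begin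
        ε (f ∘ τ a) * ∏ (λ i → A i (f (τ a i)))         ≈⟨ *-cong (ε-∘τ a f)
                                                             (∏-cong λ i → sym (τ-rows A a rows≈ i (f (τ a i)))) ⟩
        - ε f * ∏ (λ i → A (τ a i) (f (τ a i)))         ≈⟨ *-congˡ (∏-permute (λ i → A i (f i)) (τ-permutation a)) ⟨
        - ε f * ∏ (λ i → A i (f i))                     ≈⟨ -‿distribˡ-* _ _ ⟨
        - (ε f * ∏ (λ i → A i (f i)))                   ∎

    det-transpose-rowAlternating : ∀ {n} → RowAlternating (λ (A : Matrix (suc n) (suc n)) → det (transpose A))
    det-transpose-rowAlternating A a rows≈ = x≈-x⇒x≈0 (begin
      det (transpose A)
        ≈⟨ ∑map-permute (τ-permutation a) (λ f≗g → *-cong (reflexive (ε-≗ f≗g))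
             (reflexive (∏-cong-≗ λ i → ≡.cong (λ k → A k i) (f≗g i)))) ⟩
      ∑map (λ f → ε (τ a ∘ f) * ∏ (λ i → A (τ a (f i)) i)) ≈⟨ ∑map-cong swapped ⟩
      ∑map (λ f → - (ε f * ∏ (λ i → A (f i) i)))     ≈⟨ -‿∑map (λ f → ε f * ∏ (λ i → A (f i) i)) ⟩
      - det (transpose A)                             ∎)
      where
      swapped : ∀ f → ε (τ a ∘ f) * ∏ (λ i → A (τ a (f i)) i) ≈ - (ε f * ∏ (λ i → A (f i) i))
      swapped f = trans (*-cong (ε-τ∘ a f) (∏-cong λ i → τ-rows A a rows≈ (f i) i)) (sym (-‿distribˡ-* _ _))

    det-* : ∀ {n} (A B : Matrix (suc n) (suc n)) → det (A *ₘ B) ≈ det A * det B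
    det-* A B = trans (det-unique (*ₘ-rowMultilinear det-rowMultilinear B) (*ₘ-rowAlternating det-rowAlternating B) A)
                      (*-congˡ (det-cong (I-*ₘ B)))

    det-transpose : ∀ {n} (A : Matrix (suc n) (suc n)) → det (transpose A) ≈ det A
    det-transpose {n} A = begin
      det (transpose A)         ≈⟨ det-unique det-transpose-rowMultilinear det-transpose-rowAlternating A ⟩
      det A * det (transpose (I {suc n}))
                                ≈⟨ *-congˡ (trans (det-cong {suc n} λ i j → reflexive (δ-sym j i)) (det-I {suc n})) ⟩
      det A * 1#                ≈⟨ *-identityʳ _ ⟩
      det A                     ∎

module InnerProduct {c ℓ} (R : CommutativeRing c ℓ) where
  open CommutativeRing R hiding (zero)
  open Determinant R
  open import Algebra.Properties.Ring ring using (+-cancelˡ)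
  open import Algebra.Properties.CommutativeSemigroup *-commutativeSemigroup using (x∙yz≈z∙yx; xy∙z≈x∙zy)
  open import Algebra.Properties.CommutativeSemigroup +-commutativeSemigroup using () renaming (interchange to +-interchange)
  open import Algebra.Properties.Semiring.Sum semiring using (∑-distrib-+) renaming (sum to ∑)
  open import Algebra.Properties.CommutativeMonoid.Sum *-commutativeMonoid using () renaming (sum to ∏)
  open import Relation.Binary.Reasoning.Setoid setoid

  ⟨_∣_∣_⟩ : ∀ {n} → (Fin n → Carrier) → (Fin n → Carrier) → (Fin n → Carrier) → Carrier
  ⟨ u ∣ w ∣ v ⟩ = ∑ (λ j → u j * (w j * v j))

  ⟨⟩-cong : ∀ {n} {u u′ v v′ : Fin n → Carrier} w → (∀ j → u j ≈ u′ j) → (∀ j → v j ≈ v′ j) →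
            ⟨ u ∣ w ∣ v ⟩ ≈ ⟨ u′ ∣ w ∣ v′ ⟩
  ⟨⟩-cong w u≈u′ v≈v′ = ∑-cong λ j → *-cong (u≈u′ j) (*-congˡ (v≈v′ j))

  ⟨⟩-sym : ∀ {n} (u w v : Fin n → Carrier) → ⟨ u ∣ w ∣ v ⟩ ≈ ⟨ v ∣ w ∣ u ⟩
  ⟨⟩-sym u w v = ∑-cong λ j → x∙yz≈z∙yx (u j) (w j) (v j)

  ⟨⟩-polarization : ∀ {n} (u w v : Fin n → Carrier) →
                    ⟨ (λ j → u j + v j) ∣ w ∣ (λ j → u j + v j) ⟩ ≈
                    (⟨ u ∣ w ∣ u ⟩ + ⟨ v ∣ w ∣ v ⟩) + (⟨ u ∣ w ∣ v ⟩ + ⟨ u ∣ w ∣ v ⟩)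
  ⟨⟩-polarization {n} u w v = trans (∑-cong {n} λ j → pointwise (u j) (w j) (v j))
    (trans (∑-distrib-+ {n} _ _) (+-cong (∑-distrib-+ {n} _ _) (∑-distrib-+ {n} _ _)))
    where
    pointwise : ∀ x y z → (x + z) * (y * (x + z)) ≈ (x * (y * x) + z * (y * z)) + (x * (y * z) + x * (y * z))
    pointwise x y z = begin
      (x + z) * (y * (x + z))                              ≈⟨ *-congˡ (distribˡ y x z) ⟩
      (x + z) * (y * x + y * z)                            ≈⟨ distribʳ _ x z ⟩
      x * (y * x + y * z) + z * (y * x + y * z)            ≈⟨ +-cong (distribˡ x _ _) (distribˡ z _ _) ⟩
      (x * (y * x) + x * (y * z)) + (z * (y * x) + z * (y * z))
                                                           ≈⟨ +-congˡ (+-cong (x∙yz≈z∙yx z y x) refl) ⟩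
      (x * (y * x) + x * (y * z)) + (x * (y * z) + z * (y * z))
                                                           ≈⟨ +-congˡ (+-comm _ _) ⟩
      (x * (y * x) + x * (y * z)) + (z * (y * z) + x * (y * z))
                                                           ≈⟨ +-interchange _ _ _ _ ⟩
      (x * (y * x) + z * (y * z)) + (x * (y * z) + x * (y * z)) ∎

  Orthonormal : ∀ {N n} → (Fin n → Carrier) → (Fin N → Fin n → Carrier) → Set ℓ
  Orthonormal w v = ∀ i i′ → ⟨ v i ∣ w ∣ v i′ ⟩ ≈ δ i i′

  ∘-orthonormal : ∀ {N N′ n} {w : Fin n → Carrier} {v : Fin N → Fin n → Carrier} {ι : Fin N′ → Fin N} →
                  Injective _≡_ _≡_ ι → Orthonormal w v → Orthonormal w (v ∘ ι)
  ∘-orthonormal {ι = ι} ι-injective v-orthonormal i i′ =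
    trans (v-orthonormal (ι i) (ι i′)) (reflexive (δ-injective ι-injective i i′))

  ++-orthonormal : ∀ {N M n} {w : Fin n → Carrier} {u : Fin N → Fin n → Carrier} {v : Fin M → Fin n → Carrier} →
                   Orthonormal w u → Orthonormal w v → (∀ i i′ → ⟨ u i ∣ w ∣ v i′ ⟩ ≈ 0#) → Orthonormal w (u ++ v)
  ++-orthonormal {N} {M} {w = w} {u} {v} u-orthonormal v-orthonormal u⊥v i i′
    with splitAt N i in eq | splitAt N i′ in eq′
  ... | inj₁ a | inj₁ a′ = trans (u-orthonormal a a′) (reflexive (≡.trans (≡.sym (δ-injective (Fin.↑ˡ-injective M _ _) a a′))
                             (≡.cong₂ δ (Fin.splitAt⁻¹-↑ˡ eq) (Fin.splitAt⁻¹-↑ˡ eq′))))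
  ... | inj₁ a | inj₂ b′ = trans (u⊥v a b′) (reflexive (≡.sym (δ-≢ (splitAt-apart N eq eq′))))
  ... | inj₂ b | inj₁ a′ = trans (⟨⟩-sym (v b) w (u a′))
                             (trans (u⊥v a′ b) (reflexive (≡.sym (δ-≢ (splitAt-apart N eq′ eq ∘ ≡.sym)))))
  ... | inj₂ b | inj₂ b′ = trans (v-orthonormal b b′) (reflexive (≡.trans (≡.sym (δ-injective (Fin.↑ʳ-injective N _ _) b b′))
                             (≡.cong₂ δ (Fin.splitAt⁻¹-↑ʳ eq) (Fin.splitAt⁻¹-↑ʳ eq′))))

  module _ (+-double-injective : ∀ {x y} → x + x ≈ y + y → x ≈ y) where

    -- Polarization recovers the bilinear form from the quadratic one.
    linearIsometry-⟨⟩ : ∀ {k n} (p : (Fin k → Carrier) → (Fin n → Carrier)) (w : Fin n → Carrier) (w′ : Fin k → Carrier) →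
                        (∀ a b j → p (λ i → a i + b i) j ≈ p a j + p b j) →
                        (∀ a → ⟨ p a ∣ w ∣ p a ⟩ ≈ ⟨ a ∣ w′ ∣ a ⟩) →
                        ∀ a b → ⟨ p a ∣ w ∣ p b ⟩ ≈ ⟨ a ∣ w′ ∣ b ⟩
    linearIsometry-⟨⟩ p w w′ p-additive p-isometry a b = +-double-injective (+-cancelˡ (Qpa + Qpb) _ _ (begin
      (Qpa + Qpb) + (⟨ p a ∣ w ∣ p b ⟩ + ⟨ p a ∣ w ∣ p b ⟩)
        ≈⟨ ⟨⟩-polarization (p a) w (p b) ⟨
      ⟨ (λ j → p a j + p b j) ∣ w ∣ (λ j → p a j + p b j) ⟩
        ≈⟨ ⟨⟩-cong w (λ j → sym (p-additive a b j)) (λ j → sym (p-additive a b j)) ⟩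
      ⟨ p a+b ∣ w ∣ p a+b ⟩
        ≈⟨ p-isometry a+b ⟩
      ⟨ a+b ∣ w′ ∣ a+b ⟩
        ≈⟨ ⟨⟩-polarization a w′ b ⟩
      (⟨ a ∣ w′ ∣ a ⟩ + ⟨ b ∣ w′ ∣ b ⟩) + (⟨ a ∣ w′ ∣ b ⟩ + ⟨ a ∣ w′ ∣ b ⟩)
        ≈⟨ +-congʳ (+-cong (p-isometry a) (p-isometry b)) ⟨
      (Qpa + Qpb) + (⟨ a ∣ w′ ∣ b ⟩ + ⟨ a ∣ w′ ∣ b ⟩) ∎))
      where
      a+b = λ i → a i + b i
      Qpa = ⟨ p a ∣ w ∣ p a ⟩
      Qpb = ⟨ p b ∣ w ∣ p b ⟩

    -- Orthonormal g R says R · diag g · Rᵀ = I; take determinants.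
    orthonormal⇒det²*∏≈1 : ∀ {n} (g : Fin (suc n) → Carrier) (R : Matrix (suc n) (suc n)) →
                           Orthonormal g R → (det R * det R) * ∏ g ≈ 1#
    orthonormal⇒det²*∏≈1 {n} g R R-orthonormal = begin
      (det R * det R) * ∏ g                     ≈⟨ xy∙z≈x∙zy _ _ _ ⟩
      det R * (∏ g * det R)                     ≈⟨ *-congˡ (*-congˡ (det-transpose +-double-injective R)) ⟨
      det R * (∏ g * det (transpose R))         ≈⟨ *-congˡ (det-scaleRows g (transpose R)) ⟨
      det R * det (λ j i → g j * R i j)          ≈⟨ det-* +-double-injective R (λ j i → g j * R i j) ⟨
      det (R *ₘ (λ j i → g j * R i j))           ≈⟨ det-cong {suc n} R-orthonormal ⟩
      det (I {suc n})                           ≈⟨ det-I {suc n} ⟩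
      1#                                        ∎

module LambdaDot {c ℓ} (F : FiniteOddField c ℓ) where
  open FiniteOddField F hiding (zero)
  open Quadratic F
  open Determinant commRing using (δ; δ-sym; ∑-cong; ∑-δ; det)
  open InnerProduct commRing
  open import Algebra.Properties.Ring ring using (xyx⁻¹≈y)
  open import Algebra.Properties.CommutativeSemigroup *-commutativeSemigroup using (x∙yz≈y∙xz; x∙yz≈xz∙y)
  open import Algebra.Properties.CommutativeMonoid.Sum *-commutativeMonoid using () renaming (sum to ∏)
  open import Algebra.Properties.Semiring.Sum semiring using (∑-distrib-+) renaming (sum to ∑)
  open import Relation.Binary.Reasoning.Setoid setoid

  +-double-injective : ∀ {x y} → x + x ≈ y + y → x ≈ y
  +-double-injective {x} {y} 2x≈2y = begin
    x                      ≈⟨ double x ⟨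
    ½ * (x + x)            ≈⟨ *-congˡ 2x≈2y ⟩
    ½ * (y + y)            ≈⟨ double y ⟩
    y                      ∎
    where
    ½ = proj₁ (inverse (1# + 1#) oddChar)
    double : ∀ z → ½ * (z + z) ≈ z
    double z = begin
      ½ * (z + z)               ≈⟨ *-congˡ (+-cong (*-identityˡ z) (*-identityˡ z)) ⟨
      ½ * (1# * z + 1# * z)     ≈⟨ *-congˡ (distribʳ z 1# 1#) ⟨
      ½ * ((1# + 1#) * z)       ≈⟨ *-assoc _ _ _ ⟨
      (½ * (1# + 1#)) * z       ≈⟨ *-congʳ (trans (*-comm _ _) (proj₂ (inverse (1# + 1#) oddChar))) ⟩
      1# * z                    ≈⟨ *-identityˡ z ⟩
      z                         ∎

  sumF≡∑ : ∀ {n} (f : Fin n → Carrier) → sumF f ≡ ∑ f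
  sumF≡∑ {zero}  f = ≡.refl
  sumF≡∑ {suc n} f = ≡.cong (f zero +_) (sumF≡∑ (λ i → f (suc i)))

  λweights : Carrier → ∀ {m} → Fin (suc m) → Carrier
  λweights λ′ {zero}  zero    = λ′
  λweights λ′ {suc m} zero    = 1#
  λweights λ′ {suc m} (suc i) = λweights λ′ i

  ∏-λweights : ∀ λ′ {m} → ∏ (λweights λ′ {m}) ≈ λ′
  ∏-λweights λ′ {zero}  = *-identityʳ λ′
  ∏-λweights λ′ {suc m} = trans (*-identityˡ _) (∏-λweights λ′ {m})

  Qλ≈⟨⟩ : ∀ λ′ {m} (u : Fin (suc m) → Carrier) → Qλ λ′ u ≈ ⟨ u ∣ λweights λ′ ∣ u ⟩
  Qλ≈⟨⟩ λ′ {zero}  u = trans (+-identityˡ _) (trans (x∙yz≈y∙xz λ′ (u zero) (u zero)) (sym (+-identityʳ _)))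
  Qλ≈⟨⟩ λ′ {suc m} u = begin
    (u zero * u zero + sumF (λ i → u (suc (inject₁ i)) * u (suc (inject₁ i))))
      + λ′ * (u (suc (fromℕ m)) * u (suc (fromℕ m)))
      ≈⟨ +-assoc _ _ _ ⟩
    u zero * u zero + Qλ λ′ (λ i → u (suc i))
      ≈⟨ +-cong (*-congˡ (*-identityˡ _)) (sym (Qλ≈⟨⟩ λ′ (λ i → u (suc i)))) ⟨
    ⟨ u ∣ λweights λ′ ∣ u ⟩ ∎

  Bλ≈2⟨⟩ : ∀ λ′ {m} (u v : Fin (suc m) → Carrier) → Bλ λ′ u v ≈ ⟨ u ∣ λweights λ′ ∣ v ⟩ + ⟨ u ∣ λweights λ′ ∣ v ⟩
  Bλ≈2⟨⟩ λ′ u v = begin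
    Qλ λ′ (u +ᵥ v) - Qλ λ′ u - Qλ λ′ v
      ≈⟨ +-cong (+-cong (trans (Qλ≈⟨⟩ λ′ (u +ᵥ v)) (⟨⟩-polarization u w v)) (-‿cong (Qλ≈⟨⟩ λ′ u)))
                (-‿cong (Qλ≈⟨⟩ λ′ v)) ⟩
    ((⟨ u ∣ w ∣ u ⟩ + ⟨ v ∣ w ∣ v ⟩) + B₂) - ⟨ u ∣ w ∣ u ⟩ - ⟨ v ∣ w ∣ v ⟩
      ≈⟨ +-congʳ (+-congʳ (+-assoc _ _ _)) ⟩
    (⟨ u ∣ w ∣ u ⟩ + (⟨ v ∣ w ∣ v ⟩ + B₂)) - ⟨ u ∣ w ∣ u ⟩ - ⟨ v ∣ w ∣ v ⟩
      ≈⟨ +-congʳ (xyx⁻¹≈y _ _) ⟩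
    (⟨ v ∣ w ∣ v ⟩ + B₂) - ⟨ v ∣ w ∣ v ⟩
      ≈⟨ xyx⁻¹≈y _ _ ⟩
    B₂ ∎
    where
    w = λweights λ′
    B₂ = ⟨ u ∣ w ∣ v ⟩ + ⟨ u ∣ w ∣ v ⟩

  dot≈⟨⟩ : ∀ {k} (a : Fin k → Carrier) → dot a ≈ ⟨ a ∣ (λ _ → 1#) ∣ a ⟩
  dot≈⟨⟩ a = trans (reflexive (sumF≡∑ (λ i → a i * a i))) (∑-cong λ i → *-congˡ (sym (*-identityˡ (a i))))

  apply-additive : ∀ {k n} (M : Fin k → Fin n → Carrier) a b j →
                   apply M (λ i → a i + b i) j ≈ apply M a j + apply M b j
  apply-additive {k} M a b j = begin
    sumF (λ i → (a i + b i) * M i j)             ≡⟨ sumF≡∑ {k} _ ⟩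
    ∑ (λ i → (a i + b i) * M i j)                ≈⟨ ∑-cong (λ i → distribʳ (M i j) (a i) (b i)) ⟩
    ∑ (λ i → a i * M i j + b i * M i j)          ≈⟨ ∑-distrib-+ (λ i → a i * M i j) (λ i → b i * M i j) ⟩
    ∑ (λ i → a i * M i j) + ∑ (λ i → b i * M i j) ≡⟨ ≡.cong₂ _+_ (sumF≡∑ {k} _) (sumF≡∑ {k} _) ⟨
    apply M a j + apply M b j                    ∎

  apply-δ : ∀ {k n} (M : Fin k → Fin n → Carrier) i j → apply M (δ i) j ≈ M i j
  apply-δ M i j = trans (reflexive (sumF≡∑ (λ l → δ i l * M l j))) (∑-δ i (λ l → M l j))

  module _ {λ′ k m} (x : DotEmbedding λ′ k (suc m)) where
    open DotEmbedding x

    embedding-⟨⟩ : ∀ a b → ⟨ apply mat a ∣ λweights λ′ ∣ apply mat b ⟩ ≈ ⟨ a ∣ (λ _ → 1#) ∣ b ⟩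
    embedding-⟨⟩ = linearIsometry-⟨⟩ +-double-injective (apply mat) (λweights λ′) (λ _ → 1#) (apply-additive mat)
      λ a → trans (sym (Qλ≈⟨⟩ λ′ (apply mat a))) (trans (isometry a) (dot≈⟨⟩ a))

    embedding-orthonormal : Orthonormal (λweights λ′) mat
    embedding-orthonormal i i′ = begin
      ⟨ mat i ∣ λweights λ′ ∣ mat i′ ⟩                     ≈⟨ ⟨⟩-cong (λweights λ′) (apply-δ mat i) (apply-δ mat i′) ⟨
      ⟨ apply mat (δ i) ∣ λweights λ′ ∣ apply mat (δ i′) ⟩ ≈⟨ embedding-⟨⟩ (δ i) (δ i′) ⟩
      ∑ (λ j → δ i j * (1# * δ i′ j))                       ≈⟨ ∑-δ i (λ j → 1# * δ i′ j) ⟩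
      1# * δ i′ i                                           ≈⟨ *-identityˡ _ ⟩
      δ i′ i                                                ≡⟨ δ-sym i′ i ⟩
      δ i i′                                                ∎

  adjacent⇒orthogonal : ∀ {λ′ k m} (x y : DotEmbedding λ′ k (suc m)) → Adjacent x y →
                        ∀ i i′ → ⟨ DotEmbedding.mat x i ∣ λweights λ′ ∣ DotEmbedding.mat y i′ ⟩ ≈ 0#
  adjacent⇒orthogonal {λ′} x y adjacent i i′ = +-double-injective (begin
    ⟨ mx i ∣ w ∣ my i′ ⟩ + ⟨ mx i ∣ w ∣ my i′ ⟩
      ≈⟨ +-cong ⟨ap⟩ ⟨ap⟩ ⟨
    ⟨ apply mx (δ i) ∣ w ∣ apply my (δ i′) ⟩ + ⟨ apply mx (δ i) ∣ w ∣ apply my (δ i′) ⟩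
      ≈⟨ Bλ≈2⟨⟩ λ′ (apply mx (δ i)) (apply my (δ i′)) ⟨
    Bλ λ′ (apply mx (δ i)) (apply my (δ i′))
      ≈⟨ adjacent (δ i) (δ i′) ⟩
    0#
      ≈⟨ +-identityʳ 0# ⟨
    0# + 0# ∎)
    where
    mx = DotEmbedding.mat x
    my = DotEmbedding.mat y
    w = λweights λ′
    ⟨ap⟩ : ⟨ apply mx (δ i) ∣ w ∣ apply my (δ i′) ⟩ ≈ ⟨ mx i ∣ w ∣ my i′ ⟩
    ⟨ap⟩ = ⟨⟩-cong w (apply-δ mx i) (apply-δ my i′)

  -- det v ² · λ = 1 would make λ = (λ · det v)² a square.
  no-orthonormal-basis : ∀ {λ′ m} → NonSquare λ′ → (v : Fin (suc m) → Fin (suc m) → Carrier) →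
                         ¬ Orthonormal (λweights λ′) v
  no-orthonormal-basis {λ′} {m} nonSquare v v-orthonormal = nonSquare (λ′ * d) (begin
    (λ′ * d) * (λ′ * d)          ≈⟨ trans (*-assoc λ′ d (λ′ * d)) (*-congˡ (x∙yz≈xz∙y d λ′ d)) ⟩
    λ′ * ((d * d) * λ′)          ≈⟨ *-congˡ (*-congˡ (∏-λweights λ′ {m})) ⟨
    λ′ * ((d * d) * ∏ w)         ≈⟨ *-congˡ (orthonormal⇒det²*∏≈1 +-double-injective w v v-orthonormal) ⟩
    λ′ * 1#                      ≈⟨ *-identityʳ λ′ ⟩
    λ′                           ∎)
    where
    d = det v
    w : Fin (suc m) → Carrier
    w = λweights λ′

  no-orthonormal-family : ∀ {λ′ m N} → NonSquare λ′ → (v : Fin N → Fin (suc m) → Carrier) → suc m ℕ.≤ N →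
                          ¬ Orthonormal (λweights λ′) v
  no-orthonormal-family {λ′} {m} nonSquare v n≤N v-orthonormal =
    no-orthonormal-basis nonSquare (v ∘ ι)
      (∘-orthonormal {w = λweights λ′} {v = v} {ι = ι} (Fin.inject≤-injective n≤N n≤N _ _) v-orthonormal)
    where
    ι = λ i → Fin.inject≤ i n≤N

  adjacent⇒orthonormal : ∀ {λ′ k m} (x y : DotEmbedding λ′ k (suc m)) → Adjacent x y →
                         Orthonormal (λweights λ′) (DotEmbedding.mat x ++ DotEmbedding.mat y)
  adjacent⇒orthonormal {λ′} x y adjacent =
    ++-orthonormal {w = λweights λ′} (embedding-orthonormal x) (embedding-orthonormal y) (adjacent⇒orthogonal x y adjacent)

open import Data.Nat using (ℕ; _≤_; _*_)

mainTheorem1 : ∀ {c ℓ} (F : FiniteOddField c ℓ) (λ' : FiniteOddField.Carrier F)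
    → Quadratic.NonSquare F λ'
    → (n k : ℕ) → 2 ≤ n → 1 ≤ k → n ≤ 2 * k
    → (x y : Quadratic.DotEmbedding F λ' k n)
    → ¬ Quadratic.Adjacent F x y
mainTheorem1 F λ' nonSquare zero    k () _ _ x y adjacent
mainTheorem1 F λ' nonSquare (suc m) k _ _ n≤2k x y adjacent =
  no-orthonormal-family nonSquare (mat x ++ mat y) n≤k+k (adjacent⇒orthonormal x y adjacent)
  where
  open LambdaDot F
  open Quadratic.DotEmbedding
  n≤k+k : suc m ≤ k ℕ.+ k
  n≤k+k = ≡.subst (suc m ≤_) (≡.cong (k ℕ.+_) (ℕ.+-identityʳ k)) n≤2k
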